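{- Let $G_1,G_2$ be unidirectional, edge-labeled Eulerian graphs with closed Eulerian trails, with alignment graph $(V,E)$, triangle set $T$, boundary matrix $[\partial]$ and vector $x^{init}$ (for fixed $s_1\in V_1,s_2\in V_2$). Then the set $\{x\in\mathbb{R}^{E}_{\ge 0}:\ \exists\, y\in\mathbb{R}^{T}\text{ with } x=x^{init}+[\partial]y\}$ equals the set of $x\in\mathbb{R}^{E}_{\ge 0}$ satisfying (i) for every vertex $u\in V$, $\sum_{e\text{ entering }u}x_e-\sum_{e\text{ leaving }u}x_e=0$, and (ii) for $i=1,2$ and every $f\in E_i$, $\sum_{e\in E}x_eI_i(e,f)=1$.
   Context: A unidirectional, edge-labeled Eulerian graph is a connected directed multigraph with edge labels, having an Eulerian trail, with all edges between the same pair of vertices pointing in the same direction. For $G_i=(V_i,E_i)$, the alignment graph has vertex set $V=V_1\times V_2$ and edge multiset $E$ consisting of: for $f_1=(u_1,v_1)\in E_1$ and $w\in V_2$ a vertical edge $\mathrm{ver}(f_1,w)=[(u_1,w),(v_1,w)]$; for $w\in V_1$ and $f_2=(u_2,v_2)\in E_2$ a horizontal edge $\mathrm{hor}(w,f_2)=[(w,u_2),(w,v_2)]$; for $f_1\in E_1,f_2\in E_2$ a diagonal edge $\mathrm{dia}(f_1,f_2)=[(u_1,u_2),(v_1,v_2)]$. $I_1(e,f)=1$ iff $e$ is $\mathrm{ver}(f,\cdot)$ or $\mathrm{dia}(f,\cdot)$; $I_2(e,f)=1$ iff $e$ is $\mathrm{hor}(\cdot,f)$ or $\mathrm{dia}(\cdot,f)$;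 otherwise 0. The set $T$ of oriented 2-simplices contains, for each $f_1=(u_1,v_1)\in E_1,f_2=(u_2,v_2)\in E_2$, the triangles $\sigma=[(u_1,u_2),(v_1,u_2),(v_1,v_2)]$ and $\sigma'=[(u_1,u_2),(u_1,v_2),(v_1,v_2)]$. The boundary matrix $[\partial]\in\mathbb{Z}^{E\times T}$ has column $\sigma$ equal to $\mathbf{1}_{\mathrm{ver}(f_1,u_2)}+\mathbf{1}_{\mathrm{hor}(v_1,f_2)}-\mathbf{1}_{\mathrm{dia}(f_1,f_2)}$ and column $\sigma'$ equal to $\mathbf{1}_{\mathrm{hor}(u_1,f_2)}+\mathbf{1}_{\mathrm{ver}(f_1,v_2)}-\mathbf{1}_{\mathrm{dia}(f_1,f_2)}$ (coefficients from $\partial[a,b,c]=[b,c]-[a,c]+[a,b]$). For $s_1\in V_1,s_2\in V_2$, $x^{init}_e=1$ if $e=\mathrm{ver}(f_1,s_2)$ for some $f_1\in E_1$ or $e=\mathrm{hor}(s_1,f_2)$ for some $f_2\in E_2$, and $x^{init}_e=0$ otherwise. -}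

module Defs where

open import Level using (Level; _⊔_) renaming (suc to lsuc)
open import Data.Nat using (ℕ; zero; suc)
open import Data.Fin using (Fin; zero; suc)
open import Data.Fin.Properties using (_≟_)
open import Data.List using (List; []; _∷_; allFin)
open import Data.List.Relation.Binary.Permutation.Propositional using (_↭_)
open import Data.Product using (Σ; ∃; _×_; _,_)
open import Data.Unit using (⊤)
open import Relation.Nullary using (¬_; yes; no)
open import Relation.Binary.PropositionalEquality using (_≡_)
open import Relation.Binary.Structures using (IsTotalOrder)
open import Algebra.Bundles using (CommutativeRing)

-- Scalars: an arbitrary ordered field (the reals ℝ are an instance).
-- The paper works over ℝ; agda-stdlib has no reals, so we state the
-- theorem for every ordered field, which includes ℝ.

record OrderedField c ℓ₁ ℓ₂ : Set (lsuc (c ⊔ ℓ₁ ⊔ ℓ₂)) where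
  field
    commutativeRing : CommutativeRing c ℓ₁
  open CommutativeRing commutativeRing public
  field
    _≤_           : Carrier → Carrier → Set ℓ₂
    isTotalOrder  : IsTotalOrder _≈_ _≤_
    +-monoˡ-≤     : ∀ {x y} z → x ≤ y → (x + z) ≤ (y + z)
    *-nonneg      : ∀ {x y} → 0# ≤ x → 0# ≤ y → 0# ≤ (x * y)
    0≉1           : ¬ (0# ≈ 1#)
    inverse       : ∀ x → ¬ (x ≈ 0#) → ∃ λ y → (x * y) ≈ 1#

-- Vertices Fin nV, edges Fin nE (a multigraph: distinct edges may have
-- the same endpoints), each edge e goes from src e to tgt e and carries
-- a label from the set L.

record LabeledDigraph (L : Set) : Set where
  field
    nV    : ℕ
    nE    : ℕ
    src   : Fin nE → Fin nV
    tgt   : Fin nE → Fin nV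
    label : Fin nE → L

module _ {L : Set} (G : LabeledDigraph L) where
  open LabeledDigraph G

  data Connected : Fin nV → Fin nV → Set where
    here  : ∀ {u} → Connected u u
    fwd   : ∀ {v} (e : Fin nE) → Connected (tgt e) v → Connected (src e) v
    bwd   : ∀ {v} (e : Fin nE) → Connected (src e) v → Connected (tgt e) v

  IsConnected : Set
  IsConnected = ∀ u v → Connected u v

  -- all edges between the same pair of vertices point in the same direction
  IsUnidirectional : Set
  IsUnidirectional = ∀ e e' → src e ≡ tgt e' → tgt e ≡ src e' → src e ≡ tgt e

  Linked : List (Fin nE) → Set
  Linked []             = ⊤
  Linked (e ∷ [])       = ⊤
  Linked (e ∷ e' ∷ es)  = (tgt e ≡ src e') × Linked (e' ∷ es)

  closesAt : Fin nE → List (Fin nE) → Set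
  closesAt first []       = ⊤
  closesAt first (e ∷ []) = tgt e ≡ src first
  closesAt first (e ∷ e' ∷ es) = closesAt first (e' ∷ es)

  IsClosed : List (Fin nE) → Set
  IsClosed []       = ⊤
  IsClosed (e ∷ es) = closesAt e (e ∷ es)

  IsClosedEulerianTrail : List (Fin nE) → Set
  IsClosedEulerianTrail es = (es ↭ allFin nE) × Linked es × IsClosed es

  HasClosedEulerianTrail : Set
  HasClosedEulerianTrail = Σ (List (Fin nE)) IsClosedEulerianTrail

  IsUEGraphClosed : Set
  IsUEGraphClosed = IsConnected × IsUnidirectional × HasClosedEulerianTrail

module Sums {c ℓ} (R : CommutativeRing c ℓ) where
  open CommutativeRing R using (Carrier; _+_; 0#; 1#)

  Σ[<_] : (n : ℕ) → (Fin n → Carrier) → Carrier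
  Σ[< zero  ] f = 0#
  Σ[< suc n ] f = f zero + Σ[< n ] (λ i → f (suc i))

  [_≟_] : ∀ {n} → Fin n → Fin n → Carrier
  [ i ≟ j ] with i ≟ j
  ... | yes _ = 1#
  ... | no  _ = 0#

module Alignment {L : Set} (G₁ G₂ : LabeledDigraph L) where
  open LabeledDigraph G₁ renaming (nV to n₁; nE to m₁; src to u₁; tgt to v₁; label to lab₁)
  open LabeledDigraph G₂ renaming (nV to n₂; nE to m₂; src to u₂; tgt to v₂; label to lab₂)

  V : Set
  V = Fin n₁ × Fin n₂

  data AEdge : Set where
    ver : Fin m₁ → Fin n₂ → AEdge
    hor : Fin n₁ → Fin m₂ → AEdge
    dia : Fin m₁ → Fin m₂ → AEdge

  tail head : AEdge → V
  tail (ver f w) = (u₁ f , w)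
  tail (hor w f) = (w , u₂ f)
  tail (dia f g) = (u₁ f , u₂ g)
  head (ver f w) = (v₁ f , w)
  head (hor w f) = (w , v₂ f)
  head (dia f g) = (v₁ f , v₂ g)

  -- oriented 2-simplices: σ f₁ f₂ = [(u₁,u₂),(v₁,u₂),(v₁,v₂)],
  --                       σ' f₁ f₂ = [(u₁,u₂),(u₁,v₂),(v₁,v₂)]
  data Tri : Set where
    σ  : Fin m₁ → Fin m₂ → Tri
    σ' : Fin m₁ → Fin m₂ → Tri

  module OverField {c ℓ₁ ℓ₂} (K : OrderedField c ℓ₁ ℓ₂) where
    open OrderedField K using (Carrier; _+_; _-_; _*_; 0#; 1#; _≈_; _≤_; commutativeRing)
    open Sums commutativeRing

    sumE : (AEdge → Carrier) → Carrier
    sumE x = Σ[< m₁ ] (λ f → Σ[< n₂ ] (λ w → x (ver f w)))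
           + (Σ[< n₁ ] (λ w → Σ[< m₂ ] (λ g → x (hor w g)))
           +  Σ[< m₁ ] (λ f → Σ[< m₂ ] (λ g → x (dia f g))))

    sumT : (Tri → Carrier) → Carrier
    sumT y = Σ[< m₁ ] (λ f → Σ[< m₂ ] (λ g → y (σ f g)))
           + Σ[< m₁ ] (λ f → Σ[< m₂ ] (λ g → y (σ' f g)))

    𝟙 : AEdge → AEdge → Carrier
    𝟙 (ver f w) (ver f' w') = [ f ≟ f' ] * [ w ≟ w' ]
    𝟙 (hor w g) (hor w' g') = [ w ≟ w' ] * [ g ≟ g' ]
    𝟙 (dia f g) (dia f' g') = [ f ≟ f' ] * [ g ≟ g' ]
    𝟙 _ _ = 0#

    ∂ : AEdge → Tri → Carrier
    ∂ e (σ  f g) = 𝟙 (ver f (u₂ g)) e + 𝟙 (hor (v₁ f) g) e - 𝟙 (dia f g) e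
    ∂ e (σ' f g) = 𝟙 (hor (u₁ f) g) e + 𝟙 (ver f (v₂ g)) e - 𝟙 (dia f g) e

    ∂· : (Tri → Carrier) → AEdge → Carrier
    ∂· y e = sumT (λ t → ∂ e t * y t)

    I₁ : AEdge → Fin m₁ → Carrier
    I₁ (ver f' _) f = [ f' ≟ f ]
    I₁ (hor _ _)  f = 0#
    I₁ (dia f' _) f = [ f' ≟ f ]

    I₂ : AEdge → Fin m₂ → Carrier
    I₂ (ver _ _)  g = 0#
    I₂ (hor _ g') g = [ g' ≟ g ]
    I₂ (dia _ g') g = [ g' ≟ g ]

    xinit : Fin n₁ → Fin n₂ → AEdge → Carrier
    xinit s₁ s₂ (ver _ w) = [ w ≟ s₂ ]
    xinit s₁ s₂ (hor w _) = [ w ≟ s₁ ]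
    xinit s₁ s₂ (dia _ _) = 0#

    [_≟V_] : V → V → Carrier
    [ (a , b) ≟V (a' , b') ] = [ a ≟ a' ] * [ b ≟ b' ]

    NonNeg : (AEdge → Carrier) → Set ℓ₂
    NonNeg x = ∀ e → 0# ≤ x e

    InAffineImage : Fin n₁ → Fin n₂ → (AEdge → Carrier) → Set (c ⊔ ℓ₁)
    InAffineImage s₁ s₂ x = ∃ λ (y : Tri → Carrier) → ∀ e → x e ≈ (xinit s₁ s₂ e + ∂· y e)

    FlowConservation : (AEdge → Carrier) → Set ℓ₁
    FlowConservation x = ∀ (u : V) →
      (sumE (λ e → [ head e ≟V u ] * x e) - sumE (λ e → [ tail e ≟V u ] * x e)) ≈ 0#

    LabelConstraints : (AEdge → Carrier) → Set ℓ₁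
    LabelConstraints x =
      (∀ (f : Fin m₁) → sumE (λ e → x e * I₁ e f) ≈ 1#) ×
      (∀ (g : Fin m₂) → sumE (λ e → x e * I₂ e g) ≈ 1#)

-- Write a = y ∘ σ and a′ = y ∘ σ′.  The diagonal coordinates of x = xinit + ∂ y read
-- x (dia f g) = − a f g − a′ f g; eliminating a′, the vertical and horizontal coordinates say
-- exactly that every row a f has divergence verticalSource x f in G₂ and every column a · g
-- has divergence horizontalSource x · g in G₁.  On connected graphs such a system is solvable
-- iff each right-hand side has total zero and the two right-hand sides are compatible,
-- div₁ (verticalSource x · w₂) w₁ = div₂ (horizontalSource x w₁) w₂.  The total-zero conditions
-- are the label constraints, and, Eulerian graphs being balanced, compatibility is flow
-- conservation.

module Submission where

open import Level using (Level; _⊔_)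
open import Data.Nat as ℕ using (zero; suc)
import Data.Nat.Properties as ℕ
open import Data.Integer as ℤ using (ℤ; -[1+_]; _⊖_)
import Data.Integer.Properties as ℤ
open import Data.Sign using (Sign)
open import Data.Fin using (Fin; zero; suc)
open import Data.Fin.Properties using (_≟_; suc-injective)
open import Data.List using ([]; _∷_; map; foldr; allFin; tabulate)
open import Data.List.Relation.Binary.Permutation.Propositional using (_↭_; ↭-sym; ↭⇒↭ₛ′)
open import Data.List.Relation.Binary.Permutation.Propositional.Properties using (map⁺)
import Data.List.Relation.Binary.Permutation.Setoid.Properties as ↭ₛ
open import Data.List.Properties using (map-tabulate)
open import Data.Maybe using (Maybe; just; nothing)
open import Data.Product using (∃; _×_; _,_)
open import Function using (_∘_)
open import Function.Bundles using (_⇔_; mk⇔; Equivalence)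
open import Relation.Nullary using (Dec; yes; no; contradiction)
open import Relation.Binary.PropositionalEquality as ≡ using (_≡_; _≢_)
open import Algebra.Bundles using (CommutativeRing)
open import Algebra.Solver.Ring.AlmostCommutativeRing
  using (_-Raw-AlmostCommutative⟶_; fromCommutativeRing)
import Algebra.Solver.Ring
open import Defs

-- Algebra.Solver.Ring needs coefficients that map homomorphically into the ring; ℤ does so for every
-- commutative ring.
module IntegerCoefficients {c ℓ} (R : CommutativeRing c ℓ) where
  open CommutativeRing R hiding (zero)
  open import Algebra.Properties.Semiring.Mult semiring using (×-homo-+; ×1-homo-*) renaming (_×_ to _·_)
  open import Algebra.Properties.Ring ring using (-‿involutive; -0#≈0#; -‿distribˡ-*; -‿distribʳ-*)
  open import Algebra.Properties.AbelianGroup +-abelianGroup using (⁻¹-∙-comm)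
  open import Algebra.Properties.CommutativeSemigroup +-commutativeSemigroup using (interchange)
  open import Relation.Binary.Reasoning.Setoid setoid

  ⟦_⟧ᶻ : ℤ → Carrier
  ⟦ ℤ.+ n ⟧ᶻ    = n · 1#
  ⟦ -[1+ n ] ⟧ᶻ = - (suc n · 1#)

  ⊖-homo : ∀ m n → ⟦ m ⊖ n ⟧ᶻ ≈ m · 1# - n · 1#
  ⊖-homo m       zero    = sym (trans (+-congˡ -0#≈0#) (+-identityʳ _))
  ⊖-homo zero    (suc n) = sym (+-identityˡ _)
  ⊖-homo (suc m) (suc n) = begin
    ⟦ suc m ⊖ suc n ⟧ᶻ                     ≡⟨ ≡.cong ⟦_⟧ᶻ (ℤ.[1+m]⊖[1+n]≡m⊖n m n) ⟩
    ⟦ m ⊖ n ⟧ᶻ                             ≈⟨ ⊖-homo m n ⟩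
    m · 1# - n · 1#                        ≈⟨ +-identityˡ _ ⟨
    0# + (m · 1# - n · 1#)                 ≈⟨ +-congʳ (-‿inverseʳ 1#) ⟨
    (1# - 1#) + (m · 1# - n · 1#)          ≈⟨ interchange _ _ _ _ ⟩
    (1# + m · 1#) + (- 1# + - (n · 1#))    ≈⟨ +-congˡ (⁻¹-∙-comm _ _) ⟩
    suc m · 1# - suc n · 1#                ∎

  +-homo : ∀ i j → ⟦ i ℤ.+ j ⟧ᶻ ≈ ⟦ i ⟧ᶻ + ⟦ j ⟧ᶻ
  +-homo (ℤ.+ m)  (ℤ.+ n)  = ×-homo-+ 1# m n
  +-homo (ℤ.+ m)  -[1+ n ] = ⊖-homo m (suc n)
  +-homo -[1+ m ] (ℤ.+ n)  = trans (⊖-homo n (suc m)) (+-comm _ _)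
  +-homo -[1+ m ] -[1+ n ] = begin
    - (suc (suc (m ℕ.+ n)) · 1#)          ≡⟨ ≡.cong (λ k → - (suc k · 1#)) (ℕ.+-suc m n) ⟨
    - ((suc m ℕ.+ suc n) · 1#)            ≈⟨ -‿cong (×-homo-+ 1# (suc m) (suc n)) ⟩
    - (suc m · 1# + suc n · 1#)           ≈⟨ ⁻¹-∙-comm _ _ ⟨
    ⟦ -[1+ m ] ⟧ᶻ + ⟦ -[1+ n ] ⟧ᶻ         ∎

  -‿homo : ∀ i → ⟦ ℤ.- i ⟧ᶻ ≈ - ⟦ i ⟧ᶻ
  -‿homo (ℤ.+ zero)  = sym -0#≈0#
  -‿homo (ℤ.+ suc n) = refl
  -‿homo -[1+ n ]    = sym (-‿involutive _)

  +◃-homo : ∀ n → ⟦ Sign.+ ℤ.◃ n ⟧ᶻ ≈ n · 1#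
  +◃-homo zero    = refl
  +◃-homo (suc n) = refl

  *-homo : ∀ i j → ⟦ i ℤ.* j ⟧ᶻ ≈ ⟦ i ⟧ᶻ * ⟦ j ⟧ᶻ
  *-homo (ℤ.+ m)     (ℤ.+ n)     = trans (+◃-homo (m ℕ.* n)) (×1-homo-* m n)
  *-homo (ℤ.+ zero)  -[1+ n ]    = sym (zeroˡ _)
  *-homo (ℤ.+ suc m) -[1+ n ]    = trans (-‿cong (×1-homo-* (suc m) (suc n))) (-‿distribʳ-* _ _)
  *-homo -[1+ m ]    (ℤ.+ zero)  = trans (reflexive (≡.cong ⟦_⟧ᶻ (ℤ.*-zeroʳ -[1+ m ]))) (sym (zeroʳ _))
  *-homo -[1+ m ]    (ℤ.+ suc n) = trans (-‿cong (×1-homo-* (suc m) (suc n))) (-‿distribˡ-* _ _)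
  *-homo -[1+ m ]    -[1+ n ]    = begin
    (suc m ℕ.* suc n) · 1#                 ≈⟨ ×1-homo-* (suc m) (suc n) ⟩
    (suc m · 1#) * (suc n · 1#)            ≈⟨ -‿involutive _ ⟨
    - - ((suc m · 1#) * (suc n · 1#))      ≈⟨ -‿cong (-‿distribˡ-* _ _) ⟩
    - (- (suc m · 1#) * (suc n · 1#))      ≈⟨ -‿distribʳ-* _ _ ⟩
    ⟦ -[1+ m ] ⟧ᶻ * ⟦ -[1+ n ] ⟧ᶻ          ∎

  homomorphism : ℤ.+-*-rawRing -Raw-AlmostCommutative⟶ fromCommutativeRing R
  homomorphism = record
    { ⟦_⟧    = ⟦_⟧ᶻ
    ; +-homo = +-homo
    ; *-homo = *-homo
    ; -‿homo = -‿homo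
    ; 0-homo = refl
    ; 1-homo = +-identityʳ 1#
    }

  ⟦⟧-weaklyDecidable : ∀ i j → Maybe (⟦ i ⟧ᶻ ≈ ⟦ j ⟧ᶻ)
  ⟦⟧-weaklyDecidable i j with i ℤ.≟ j
  ... | yes ≡.refl = just refl
  ... | no _       = nothing

  open Algebra.Solver.Ring ℤ.+-*-rawRing (fromCommutativeRing R) homomorphism ⟦⟧-weaklyDecidable public

module FiniteSums {c ℓ} (R : CommutativeRing c ℓ) where
  open CommutativeRing R hiding (zero)
  open Sums R
  open import Algebra.Properties.Semiring.Sum semiring public
  open import Algebra.Properties.Ring ring using (-0#≈0#)
  open import Algebra.Properties.AbelianGroup +-abelianGroup using (⁻¹-∙-comm)
  open import Relation.Binary.Reasoning.Setoid setoid

  Σ[<]≡sum : ∀ n (f : Fin n → Carrier) → Σ[< n ] f ≡ sum f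
  Σ[<]≡sum zero    f = ≡.refl
  Σ[<]≡sum (suc n) f = ≡.cong (f zero +_) (Σ[<]≡sum n (λ i → f (suc i)))

  ∑-distrib-neg : ∀ {n} (f : Fin n → Carrier) → ∑[ i < n ] (- f i) ≈ - sum f
  ∑-distrib-neg {zero}  f = sym -0#≈0#
  ∑-distrib-neg {suc n} f = trans (+-congˡ (∑-distrib-neg (λ i → f (suc i)))) (⁻¹-∙-comm _ _)

  ∑-distrib-sub : ∀ {n} (f g : Fin n → Carrier) → ∑[ i < n ] (f i - g i) ≈ sum f - sum g
  ∑-distrib-sub f g = trans (∑-distrib-+ f (λ i → - g i)) (+-congˡ (∑-distrib-neg g))

  -- Sizes are explicit: `sum` recurses on the length, which Agda cannot infer from the summands.
  ∑-cong : ∀ n {f g : Fin n → Carrier} → (∀ i → f i ≈ g i) → sum f ≈ sum g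
  ∑-cong n = sum-cong-≋

  ∑-zero : ∀ n {f : Fin n → Carrier} → (∀ i → f i ≈ 0#) → sum f ≈ 0#
  ∑-zero n f≈0 = trans (∑-cong n f≈0) (sum-replicate-zero n)

  ≡⇒[≟]≡1 : ∀ {n} {i j : Fin n} → i ≡ j → [ i ≟ j ] ≡ 1#
  ≡⇒[≟]≡1 {i = i} {j} i≡j with i ≟ j
  ... | yes _  = ≡.refl
  ... | no i≢j = contradiction i≡j i≢j

  ≢⇒[≟]≡0 : ∀ {n} {i j : Fin n} → i ≢ j → [ i ≟ j ] ≡ 0#
  ≢⇒[≟]≡0 {i = i} {j} i≢j with i ≟ j
  ... | yes i≡j = contradiction i≡j i≢j
  ... | no _    = ≡.refl

  [≟]-sym : ∀ {n} (i j : Fin n) → [ i ≟ j ] ≡ [ j ≟ i ]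
  [≟]-sym i j with i ≟ j
  ... | yes i≡j = ≡.sym (≡⇒[≟]≡1 (≡.sym i≡j))
  ... | no i≢j  = ≡.sym (≢⇒[≟]≡0 (λ j≡i → i≢j (≡.sym j≡i)))

  [suc≟suc] : ∀ {n} (i j : Fin n) → [ suc i ≟ suc j ] ≡ [ i ≟ j ]
  [suc≟suc] i j = by-cases (i ≟ j)
    where
    by-cases : Dec (i ≡ j) → [ suc i ≟ suc j ] ≡ [ i ≟ j ]
    by-cases (yes i≡j) = ≡.trans (≡⇒[≟]≡1 (≡.cong suc i≡j)) (≡.sym (≡⇒[≟]≡1 i≡j))
    by-cases (no i≢j)  = ≡.trans (≢⇒[≟]≡0 (i≢j ∘ suc-injective)) (≡.sym (≢⇒[≟]≡0 i≢j))

  ∑-select : ∀ {n} (j : Fin n) (f : Fin n → Carrier) → ∑[ i < n ] ([ i ≟ j ] * f i) ≈ f j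
  ∑-select {suc n} zero f = begin
    [ zero {n} ≟ zero ] * f zero + ∑[ i < n ] ([ suc i ≟ zero ] * f (suc i))
      ≈⟨ +-cong (*-congʳ (reflexive (≡⇒[≟]≡1 {i = zero {n}} ≡.refl)))
                (∑-zero n (λ i → trans (*-congʳ (reflexive (≢⇒[≟]≡0 {i = suc i} {zero} λ ()))) (zeroˡ _))) ⟩
    1# * f zero + 0#
      ≈⟨ trans (+-identityʳ _) (*-identityˡ _) ⟩
    f zero ∎
  ∑-select {suc n} (suc j) f = begin
    [ zero ≟ suc j ] * f zero + ∑[ i < n ] ([ suc i ≟ suc j ] * f (suc i))
      ≈⟨ +-cong (trans (*-congʳ (reflexive (≢⇒[≟]≡0 {i = zero} {suc j} λ ()))) (zeroˡ _))
                (∑-cong n (λ i → *-congʳ (reflexive ([suc≟suc] i j)))) ⟩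
    0# + ∑[ i < n ] ([ i ≟ j ] * f (suc i))
      ≈⟨ trans (+-identityˡ _) (∑-select j (λ i → f (suc i))) ⟩
    f (suc j) ∎

  ∑-selectʳ : ∀ {n} (j : Fin n) (f : Fin n → Carrier) → ∑[ i < n ] (f i * [ i ≟ j ]) ≈ f j
  ∑-selectʳ {n} j f = trans (∑-cong n (λ i → *-comm _ _)) (∑-select j f)

  ∑-indicator : ∀ {n} (j : Fin n) → ∑[ i < n ] [ i ≟ j ] ≈ 1#
  ∑-indicator {n} j = trans (∑-cong n (λ i → sym (*-identityʳ _))) (∑-select j (λ _ → 1#))

  ∑-indicator′ : ∀ {n} (j : Fin n) → ∑[ i < n ] [ j ≟ i ] ≈ 1#
  ∑-indicator′ {n} j = trans (reflexive (sum-cong-≗ {n} (λ i → [≟]-sym j i))) (∑-indicator j)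

  ΣΣ≡∑∑ : ∀ n m (F : Fin n → Fin m → Carrier) →
          Σ[< n ] (λ i → Σ[< m ] (F i)) ≡ ∑[ i < n ] ∑[ j < m ] F i j
  ΣΣ≡∑∑ n m F = ≡.trans (Σ[<]≡sum n _) (sum-cong-≗ {n} (λ i → Σ[<]≡sum m (F i)))

  ∑∑-distrib-sub : ∀ {n m} (F H : Fin n → Fin m → Carrier) →
                 ∑[ i < n ] ∑[ j < m ] (F i j - H i j) ≈ ∑[ i < n ] ∑[ j < m ] F i j - ∑[ i < n ] ∑[ j < m ] H i j
  ∑∑-distrib-sub {n} F H = trans (∑-cong n (λ i → ∑-distrib-sub (F i) (H i))) (∑-distrib-sub {n} _ _)

  ∑∑-cong : ∀ n m {F H : Fin n → Fin m → Carrier} → (∀ i j → F i j ≈ H i j) →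
            ∑[ i < n ] ∑[ j < m ] F i j ≈ ∑[ i < n ] ∑[ j < m ] H i j
  ∑∑-cong n m F≈H = ∑-cong n (λ i → ∑-cong m (F≈H i))

  ∑∑-distrib-+ : ∀ {n m} (F H : Fin n → Fin m → Carrier) →
                 ∑[ i < n ] ∑[ j < m ] (F i j + H i j) ≈ ∑[ i < n ] ∑[ j < m ] F i j + ∑[ i < n ] ∑[ j < m ] H i j
  ∑∑-distrib-+ {n} F H = trans (∑-cong n (λ i → ∑-distrib-+ (F i) (H i))) (∑-distrib-+ {n} _ _)

  ∑∑-select : ∀ {n m} (i₀ : Fin n) (F : Fin n → Fin m → Carrier) →
              ∑[ i < n ] ∑[ j < m ] ([ i ≟ i₀ ] * F i j) ≈ ∑[ j < m ] F i₀ j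
  ∑∑-select {n} i₀ F = trans (∑-cong n (λ i → sym (*-distribˡ-sum _ (F i)))) (∑-select i₀ (λ i → sum (F i)))

  ∑∑-selectʳ : ∀ {n m} (i₀ : Fin n) (F : Fin n → Fin m → Carrier) →
               ∑[ i < n ] ∑[ j < m ] (F i j * [ i ≟ i₀ ]) ≈ ∑[ j < m ] F i₀ j
  ∑∑-selectʳ {n} i₀ F = trans (∑-cong n (λ i → sym (*-distribʳ-sum _ (F i)))) (∑-selectʳ i₀ (λ i → sum (F i)))

  ∑∑-indicator′ : ∀ {n m} (p : Fin m → Fin n) (h : Fin m → Carrier) →
                  ∑[ i < n ] ∑[ j < m ] ([ p j ≟ i ] * h j) ≈ sum h
  ∑∑-indicator′ {n} {m} p h = begin
    ∑[ i < n ] ∑[ j < m ] ([ p j ≟ i ] * h j)   ≈⟨ ∑-comm {n} {m} _ ⟩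
    ∑[ j < m ] ∑[ i < n ] ([ p j ≟ i ] * h j)   ≈⟨ ∑-cong m (λ j → *-distribʳ-sum (h j) (λ i → [ p j ≟ i ])) ⟨
    ∑[ j < m ] (∑[ i < n ] [ p j ≟ i ] * h j)   ≈⟨ ∑-cong m (λ j → trans (*-congʳ (∑-indicator′ (p j))) (*-identityˡ _)) ⟩
    sum h                                       ∎

module GraphDivergence {c ℓ} (R : CommutativeRing c ℓ) {L : Set} (G : LabeledDigraph L) where
  open CommutativeRing R hiding (zero)
  open Sums R
  open FiniteSums R
  open IntegerCoefficients R using (solve; _:=_; _:+_; _:-_; _:*_; :-_)
  open LabeledDigraph G
  open import Algebra.Properties.Ring ring using (-0#≈0#; -‿distribʳ-*)
  open import Algebra.Properties.CommutativeSemigroup *-commutativeSemigroup using (x∙yz≈y∙xz)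
  open import Relation.Binary.Reasoning.Setoid setoid

  incidence : Fin nE → Fin nV → Carrier
  incidence e w = [ src e ≟ w ] - [ tgt e ≟ w ]

  divergence : (Fin nE → Carrier) → Fin nV → Carrier
  divergence h w = ∑[ e < nE ] (incidence e w * h e)

  ∑-incidence : ∀ e → ∑[ w < nV ] incidence e w ≈ 0#
  ∑-incidence e = begin
    ∑[ w < nV ] ([ src e ≟ w ] - [ tgt e ≟ w ])     ≈⟨ ∑-distrib-sub {nV} _ _ ⟩
    ∑[ w < nV ] [ src e ≟ w ] - ∑[ w < nV ] [ tgt e ≟ w ]
      ≈⟨ +-cong (∑-indicator′ (src e)) (-‿cong (∑-indicator′ (tgt e))) ⟩
    1# - 1#                                         ≈⟨ -‿inverseʳ 1# ⟩
    0#                                              ∎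

  ∑-divergence : ∀ h → ∑[ w < nV ] divergence h w ≈ 0#
  ∑-divergence h = begin
    ∑[ w < nV ] ∑[ e < nE ] (incidence e w * h e)   ≈⟨ ∑-comm {nV} {nE} _ ⟩
    ∑[ e < nE ] ∑[ w < nV ] (incidence e w * h e)   ≈⟨ ∑-cong nE (λ e → *-distribʳ-sum (h e) (λ w → incidence e w)) ⟨
    ∑[ e < nE ] (∑[ w < nV ] incidence e w * h e)   ≈⟨ ∑-zero nE (λ e → trans (*-congʳ (∑-incidence e)) (zeroˡ _)) ⟩
    0#                                              ∎

  divergence-cong : ∀ {h k} → (∀ e → h e ≈ k e) → ∀ w → divergence h w ≈ divergence k w
  divergence-cong h≈k w = ∑-cong nE (λ e → *-congˡ (h≈k e))

  divergence-+ : ∀ h k w → divergence (λ e → h e + k e) w ≈ divergence h w + divergence k w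
  divergence-+ h k w = trans (∑-cong nE (λ e → distribˡ _ _ _)) (∑-distrib-+ {nE} _ _)

  divergence-sub : ∀ h k w → divergence (λ e → h e - k e) w ≈ divergence h w - divergence k w
  divergence-sub h k w = trans (∑-cong nE (λ e → trans (distribˡ _ _ _) (+-congˡ (sym (-‿distribʳ-* _ _)))))
                             (∑-distrib-sub {nE} _ _)

  divergence-*ˡ : ∀ a h w → divergence (λ e → a * h e) w ≈ a * divergence h w
  divergence-*ˡ a h w = begin
    ∑[ e < nE ] (incidence e w * (a * h e))   ≈⟨ ∑-cong nE (λ e → x∙yz≈y∙xz _ _ _) ⟩
    ∑[ e < nE ] (a * (incidence e w * h e))   ≈⟨ *-distribˡ-sum {nE} a _ ⟨
    a * divergence h w                        ∎

  foldr-tabulate : ∀ {n} (f : Fin n → Carrier) → foldr _+_ 0# (tabulate f) ≡ sum f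
  foldr-tabulate {zero}  f = ≡.refl
  foldr-tabulate {suc n} f = ≡.cong (f zero +_) (foldr-tabulate (f ∘ suc))

  foldr-map-↭ : ∀ (h : Fin nE → Carrier) {es es′} → es ↭ es′ →
                foldr _+_ 0# (map h es) ≈ foldr _+_ 0# (map h es′)
  foldr-map-↭ h es↭es′ =
    ↭ₛ.foldr-commMonoid setoid +-isCommutativeMonoid (↭⇒↭ₛ′ isEquivalence (map⁺ h es↭es′))

  closed-trail-telescopes : ∀ w first e es → Linked G (e ∷ es) → closesAt G first (e ∷ es) →
    foldr _+_ 0# (map (λ e → incidence e w) (e ∷ es)) ≈ [ src e ≟ w ] - [ src first ≟ w ]
  closed-trail-telescopes w first e []         _              closes =
    trans (+-identityʳ _) (reflexive (≡.cong (λ v → [ src e ≟ w ] - [ v ≟ w ]) closes))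
  closed-trail-telescopes w first e (e′ ∷ es) (linked , rest) closes = begin
    incidence e w + foldr _+_ 0# (map (λ e → incidence e w) (e′ ∷ es))
      ≈⟨ +-congˡ (closed-trail-telescopes w first e′ es rest closes) ⟩
    ([ src e ≟ w ] - [ tgt e ≟ w ]) + ([ src e′ ≟ w ] - [ src first ≟ w ])
      ≡⟨ ≡.cong (λ v → ([ src e ≟ w ] - [ tgt e ≟ w ]) + ([ v ≟ w ] - [ src first ≟ w ])) linked ⟨
    ([ src e ≟ w ] - [ tgt e ≟ w ]) + ([ tgt e ≟ w ] - [ src first ≟ w ])
      ≈⟨ solve 3 (λ a b d → (a :- b) :+ (b :- d) := a :- d) refl _ _ _ ⟩
    [ src e ≟ w ] - [ src first ≟ w ] ∎

  closedEulerian⇒balanced : HasClosedEulerianTrail G → ∀ w → ∑[ e < nE ] incidence e w ≈ 0#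
  closedEulerian⇒balanced (es , es↭edges , linked , closed) w = begin
    ∑[ e < nE ] incidence e w                              ≡⟨ foldr-tabulate (λ e → incidence e w) ⟨
    foldr _+_ 0# (tabulate (λ e → incidence e w))          ≡⟨ ≡.cong (foldr _+_ 0#) (map-tabulate (λ e → e) (λ e → incidence e w)) ⟨
    foldr _+_ 0# (map (λ e → incidence e w) (allFin nE))   ≈⟨ foldr-map-↭ _ (↭-sym es↭edges) ⟩
    foldr _+_ 0# (map (λ e → incidence e w) es)            ≈⟨ trail-sum es linked closed ⟩
    0#                                                     ∎
    where
    trail-sum : ∀ es → Linked G es → IsClosed G es → foldr _+_ 0# (map (λ e → incidence e w) es) ≈ 0#
    trail-sum []       _      _      = refl
    trail-sum (e ∷ es) linked closed =
      trans (closed-trail-telescopes w e e es linked closed) (-‿inverseʳ _)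

  divergence-const : (∀ w → ∑[ e < nE ] incidence e w ≈ 0#) → ∀ a w → divergence (λ _ → a) w ≈ 0#
  divergence-const balanced a w =
    trans (sym (*-distribʳ-sum {nE} a (λ e → incidence e w))) (trans (*-congʳ (balanced w)) (zeroˡ a))

  route : ∀ {u v} → Connected G u v → Fin nE → Carrier
  route here      e′ = 0#
  route (fwd e p) e′ = [ e′ ≟ e ] + route p e′
  route (bwd e p) e′ = route p e′ - [ e′ ≟ e ]

  divergence-indicator : ∀ e w → divergence (λ e′ → [ e′ ≟ e ]) w ≈ incidence e w
  divergence-indicator e w = ∑-selectʳ e (λ e′ → incidence e′ w)

  divergence-route : ∀ {u v} (p : Connected G u v) w → divergence (route p) w ≈ [ u ≟ w ] - [ v ≟ w ]
  divergence-route {u} here w = trans (∑-zero nE (λ e → zeroʳ _)) (sym (-‿inverseʳ [ u ≟ w ]))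
  divergence-route {v = v} (fwd e p) w = begin
    divergence (λ e′ → [ e′ ≟ e ] + route p e′) w
      ≈⟨ divergence-+ _ _ w ⟩
    divergence (λ e′ → [ e′ ≟ e ]) w + divergence (route p) w
      ≈⟨ +-cong (divergence-indicator e w) (divergence-route p w) ⟩
    ([ src e ≟ w ] - [ tgt e ≟ w ]) + ([ tgt e ≟ w ] - [ v ≟ w ])
      ≈⟨ solve 3 (λ a b d → (a :- b) :+ (b :- d) := a :- d) refl _ _ _ ⟩
    [ src e ≟ w ] - [ v ≟ w ] ∎
  divergence-route {v = v} (bwd e p) w = begin
    divergence (λ e′ → route p e′ - [ e′ ≟ e ]) w
      ≈⟨ divergence-sub _ _ w ⟩
    divergence (route p) w - divergence (λ e′ → [ e′ ≟ e ]) w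
      ≈⟨ +-cong (divergence-route p w) (-‿cong (divergence-indicator e w)) ⟩
    ([ src e ≟ w ] - [ v ≟ w ]) - ([ src e ≟ w ] - [ tgt e ≟ w ])
      ≈⟨ solve 3 (λ a b d → (a :- d) :- (a :- b) := b :- d) refl _ _ _ ⟩
    [ tgt e ≟ w ] - [ v ≟ w ] ∎

  divergence-∑ : ∀ {n} (H : Fin n → Fin nE → Carrier) w →
                 divergence (λ e → ∑[ v < n ] H v e) w ≈ ∑[ v < n ] divergence (H v) w
  divergence-∑ {n} H w = begin
    ∑[ e < nE ] (incidence e w * ∑[ v < n ] H v e)   ≈⟨ ∑-cong nE (λ e → *-distribˡ-sum (incidence e w) (λ v → H v e)) ⟩
    ∑[ e < nE ] ∑[ v < n ] (incidence e w * H v e)   ≈⟨ ∑-comm {nE} {n} _ ⟩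
    ∑[ v < n ] divergence (H v) w                    ∎

  -- Every vertex v ships its supply r v to s along a fixed path; the total supply piles up at s.
  transport : IsConnected G → Fin nV → (Fin nV → Carrier) → Fin nE → Carrier
  transport connected s r e = ∑[ v < nV ] (r v * route (connected v s) e)

  divergence-transport : ∀ connected s r → ∑[ v < nV ] r v ≈ 0# →
                         ∀ w → divergence (transport connected s r) w ≈ r w
  divergence-transport connected s r ∑r≈0 w = begin
    divergence (λ e → ∑[ v < nV ] (r v * route (connected v s) e)) w
      ≈⟨ divergence-∑ {nV} _ w ⟩
    ∑[ v < nV ] divergence (λ e → r v * route (connected v s) e) w
      ≈⟨ ∑-cong nV (λ v → trans (divergence-*ˡ (r v) _ w) (*-congˡ (divergence-route (connected v s) w))) ⟩
    ∑[ v < nV ] (r v * ([ v ≟ w ] - [ s ≟ w ]))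
      ≈⟨ ∑-cong nV (λ v → solve 3 (λ x a b → x :* (a :- b) := x :* a :- x :* b) refl _ _ _) ⟩
    ∑[ v < nV ] (r v * [ v ≟ w ] - r v * [ s ≟ w ])
      ≈⟨ ∑-distrib-sub {nV} _ _ ⟩
    ∑[ v < nV ] (r v * [ v ≟ w ]) - ∑[ v < nV ] (r v * [ s ≟ w ])
      ≈⟨ +-cong (∑-selectʳ w r) (-‿cong (sym (*-distribʳ-sum [ s ≟ w ] r))) ⟩
    r w - ∑[ v < nV ] r v * [ s ≟ w ]
      ≈⟨ +-congˡ (-‿cong (trans (*-congʳ ∑r≈0) (zeroˡ _))) ⟩
    r w - 0#
      ≈⟨ trans (+-congˡ -0#≈0#) (+-identityʳ _) ⟩
    r w ∎

module ProductDivergence {c ℓ} (R : CommutativeRing c ℓ) {L : Set} (G₁ G₂ : LabeledDigraph L) where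
  open CommutativeRing R hiding (zero)
  open FiniteSums R
  open IntegerCoefficients R using (solve; _:=_; _:+_; _:-_)
  open LabeledDigraph G₁ using () renaming (nV to n₁; nE to m₁)
  open LabeledDigraph G₂ using () renaming (nV to n₂; nE to m₂)
  module D₁ = GraphDivergence R G₁
  module D₂ = GraphDivergence R G₂
  open import Relation.Binary.Reasoning.Setoid setoid

  divergence-comm : ∀ (a : Fin m₁ → Fin m₂ → Carrier) w₁ w₂ →
    D₁.divergence (λ f → D₂.divergence (a f) w₂) w₁ ≈ D₂.divergence (λ g → D₁.divergence (λ f → a f g) w₁) w₂
  divergence-comm a w₁ w₂ = begin
    D₁.divergence (λ f → D₂.divergence (a f) w₂) w₁
      ≈⟨ ∑-cong m₁ (λ f → D₂.divergence-*ˡ (D₁.incidence f w₁) (a f) w₂) ⟨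
    ∑[ f < m₁ ] D₂.divergence (λ g → D₁.incidence f w₁ * a f g) w₂
      ≈⟨ D₂.divergence-∑ {m₁} _ w₂ ⟨
    D₂.divergence (λ g → D₁.divergence (λ f → a f g) w₁) w₂ ∎

  IsDivergenceSolution : (Fin m₁ → Fin n₂ → Carrier) → (Fin n₁ → Fin m₂ → Carrier) →
                         (Fin m₁ → Fin m₂ → Carrier) → Set ℓ
  IsDivergenceSolution r t a =
    (∀ f w → D₂.divergence (a f) w ≈ r f w) × (∀ w g → D₁.divergence (λ f → a f g) w ≈ t w g)

  -- The matrix a is built in two passes: first each row gets the prescribed G₂-divergence
  -- by transport in G₂, then a correction transported in G₁ fixes the G₁-divergences
  -- without changing the G₂-divergences, which is where compatibility enters.
  divergence-system-solvable :
    IsConnected G₁ → IsConnected G₂ → Fin n₁ → Fin n₂ →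
    (r : Fin m₁ → Fin n₂ → Carrier) (t : Fin n₁ → Fin m₂ → Carrier) →
    (∀ f → ∑[ w < n₂ ] r f w ≈ 0#) → (∀ g → ∑[ w < n₁ ] t w g ≈ 0#) →
    (∀ w₁ w₂ → D₁.divergence (λ f → r f w₂) w₁ ≈ D₂.divergence (t w₁) w₂) →
    ∃ (IsDivergenceSolution r t)
  divergence-system-solvable connected₁ connected₂ s₁ s₂ r t ∑r≈0 ∑t≈0 compatible =
    (λ f g → a₀ f g + b f g) , rows , columns
    where
    a₀ : Fin m₁ → Fin m₂ → Carrier
    a₀ f = D₂.transport connected₂ s₂ (r f)

    divergence-a₀ : ∀ f w → D₂.divergence (a₀ f) w ≈ r f w
    divergence-a₀ f = D₂.divergence-transport connected₂ s₂ (r f) (∑r≈0 f)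

    t′ : Fin n₁ → Fin m₂ → Carrier
    t′ w g = t w g - D₁.divergence (λ f → a₀ f g) w

    ∑t′≈0 : ∀ g → ∑[ w < n₁ ] t′ w g ≈ 0#
    ∑t′≈0 g = begin
      ∑[ w < n₁ ] (t w g - D₁.divergence (λ f → a₀ f g) w)            ≈⟨ ∑-distrib-sub {n₁} _ _ ⟩
      ∑[ w < n₁ ] t w g - ∑[ w < n₁ ] D₁.divergence (λ f → a₀ f g) w  ≈⟨ +-cong (∑t≈0 g) (-‿cong (D₁.∑-divergence _)) ⟩
      0# - 0#                                                          ≈⟨ -‿inverseʳ 0# ⟩
      0#                                                               ∎

    divergence-t′ : ∀ w w₂ → D₂.divergence (t′ w) w₂ ≈ 0#
    divergence-t′ w w₂ = begin
      D₂.divergence (t′ w) w₂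
        ≈⟨ D₂.divergence-sub _ _ w₂ ⟩
      D₂.divergence (t w) w₂ - D₂.divergence (λ g → D₁.divergence (λ f → a₀ f g) w) w₂
        ≈⟨ +-congˡ (-‿cong (divergence-comm a₀ w w₂)) ⟨
      D₂.divergence (t w) w₂ - D₁.divergence (λ f → D₂.divergence (a₀ f) w₂) w
        ≈⟨ +-congˡ (-‿cong (trans (D₁.divergence-cong (λ f → divergence-a₀ f w₂) w) (compatible w w₂))) ⟩
      D₂.divergence (t w) w₂ - D₂.divergence (t w) w₂
        ≈⟨ -‿inverseʳ _ ⟩
      0# ∎

    b : Fin m₁ → Fin m₂ → Carrier
    b f g = D₁.transport connected₁ s₁ (λ w → t′ w g) f

    divergence-b-row : ∀ f w₂ → D₂.divergence (b f) w₂ ≈ 0#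
    divergence-b-row f w₂ = begin
      D₂.divergence (λ g → ∑[ w < n₁ ] (t′ w g * D₁.route (connected₁ w s₁) f)) w₂
        ≈⟨ D₂.divergence-cong (λ g → ∑-cong n₁ (λ w → *-comm _ _)) w₂ ⟩
      D₂.divergence (λ g → ∑[ w < n₁ ] (D₁.route (connected₁ w s₁) f * t′ w g)) w₂
        ≈⟨ D₂.divergence-∑ {n₁} _ w₂ ⟩
      ∑[ w < n₁ ] D₂.divergence (λ g → D₁.route (connected₁ w s₁) f * t′ w g) w₂
        ≈⟨ ∑-zero n₁ (λ w → trans (D₂.divergence-*ˡ _ _ w₂) (trans (*-congˡ (divergence-t′ w w₂)) (zeroʳ _))) ⟩
      0# ∎

    rows : ∀ f w → D₂.divergence (λ g → a₀ f g + b f g) w ≈ r f w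
    rows f w = trans (D₂.divergence-+ _ _ w)
                     (trans (+-cong (divergence-a₀ f w) (divergence-b-row f w)) (+-identityʳ _))

    columns : ∀ w g → D₁.divergence (λ f → a₀ f g + b f g) w ≈ t w g
    columns w g = begin
      D₁.divergence (λ f → a₀ f g + b f g) w
        ≈⟨ D₁.divergence-+ _ _ w ⟩
      D₁.divergence (λ f → a₀ f g) w + D₁.divergence (λ f → b f g) w
        ≈⟨ +-congˡ (D₁.divergence-transport connected₁ s₁ (λ w → t′ w g) (∑t′≈0 g) w) ⟩
      D₁.divergence (λ f → a₀ f g) w + (t w g - D₁.divergence (λ f → a₀ f g) w)
        ≈⟨ solve 2 (λ d x → d :+ (x :- d) := x) refl _ _ ⟩
      t w g ∎

module AlignmentFlows {c ℓ₁ ℓ₂} (K : OrderedField c ℓ₁ ℓ₂) {L : Set} (G₁ G₂ : LabeledDigraph L)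
                      (s₁ : Fin (LabeledDigraph.nV G₁)) (s₂ : Fin (LabeledDigraph.nV G₂)) where
  open OrderedField K using (commutativeRing)
  open CommutativeRing commutativeRing hiding (zero)
  open Sums commutativeRing
  open FiniteSums commutativeRing
  open IntegerCoefficients commutativeRing using (solve; _:=_; _:+_; _:-_; _:*_; :-_; con)
  open LabeledDigraph G₁ using () renaming (nV to n₁; nE to m₁; src to u₁; tgt to v₁)
  open LabeledDigraph G₂ using () renaming (nV to n₂; nE to m₂; src to u₂; tgt to v₂)
  open Alignment G₁ G₂
  open OverField K
  open ProductDivergence commutativeRing G₁ G₂ public
  open import Algebra.Properties.AbelianGroup +-abelianGroup
    using (x≈y⇒x∙y⁻¹≈ε; x∙y⁻¹≈ε⇒x≈y; identityʳ-unique)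
  open import Algebra.Properties.Ring ring using (-0#≈0#)
  open import Relation.Binary.Reasoning.Setoid setoid

  sumE≡∑∑ : ∀ X → sumE X ≡ ∑[ f < m₁ ] ∑[ w < n₂ ] X (ver f w)
                         + (∑[ w < n₁ ] ∑[ g < m₂ ] X (hor w g) + ∑[ f < m₁ ] ∑[ g < m₂ ] X (dia f g))
  sumE≡∑∑ X = ≡.cong₂ _+_ (ΣΣ≡∑∑ m₁ n₂ _) (≡.cong₂ _+_ (ΣΣ≡∑∑ n₁ m₂ _) (ΣΣ≡∑∑ m₁ m₂ _))

  sumT≡∑∑ : ∀ Y → sumT Y ≡ ∑[ f < m₁ ] ∑[ g < m₂ ] Y (σ f g) + ∑[ f < m₁ ] ∑[ g < m₂ ] Y (σ' f g)
  sumT≡∑∑ Y = ≡.cong₂ _+_ (ΣΣ≡∑∑ m₁ m₂ _) (ΣΣ≡∑∑ m₁ m₂ _)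

  ∂·-ver : ∀ y f w → ∂· y (ver f w) ≈ ∑[ g < m₂ ] ([ u₂ g ≟ w ] * y (σ f g) + [ v₂ g ≟ w ] * y (σ' f g))
  ∂·-ver y f w = begin
    ∂· y (ver f w)
      ≡⟨ sumT≡∑∑ (λ t → ∂ (ver f w) t * y t) ⟩
    ∑[ f′ < m₁ ] ∑[ g < m₂ ] ((([ f′ ≟ f ] * [ u₂ g ≟ w ] + 0#) - 0#) * y (σ f′ g))
      + ∑[ f′ < m₁ ] ∑[ g < m₂ ] (((0# + [ f′ ≟ f ] * [ v₂ g ≟ w ]) - 0#) * y (σ' f′ g))
      ≈⟨ +-cong (∑∑-cong m₁ m₂ (λ f′ g → solve 4 (λ p q a z → ((p :* q :+ z) :- z) :* a := p :* (q :* a)) refl _ _ _ _))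
                (∑∑-cong m₁ m₂ (λ f′ g → solve 4 (λ p q a z → ((z :+ p :* q) :- z) :* a := p :* (q :* a)) refl _ _ _ _)) ⟩
    ∑[ f′ < m₁ ] ∑[ g < m₂ ] ([ f′ ≟ f ] * ([ u₂ g ≟ w ] * y (σ f′ g)))
      + ∑[ f′ < m₁ ] ∑[ g < m₂ ] ([ f′ ≟ f ] * ([ v₂ g ≟ w ] * y (σ' f′ g)))
      ≈⟨ +-cong (∑∑-select {m₁} {m₂} f _) (∑∑-select {m₁} {m₂} f _) ⟩
    ∑[ g < m₂ ] ([ u₂ g ≟ w ] * y (σ f g)) + ∑[ g < m₂ ] ([ v₂ g ≟ w ] * y (σ' f g))
      ≈⟨ ∑-distrib-+ {m₂} _ _ ⟨
    ∑[ g < m₂ ] ([ u₂ g ≟ w ] * y (σ f g) + [ v₂ g ≟ w ] * y (σ' f g)) ∎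

  ∂·-hor : ∀ y w g → ∂· y (hor w g) ≈ ∑[ f < m₁ ] ([ v₁ f ≟ w ] * y (σ f g) + [ u₁ f ≟ w ] * y (σ' f g))
  ∂·-hor y w g = begin
    ∂· y (hor w g)
      ≡⟨ sumT≡∑∑ (λ t → ∂ (hor w g) t * y t) ⟩
    ∑[ f < m₁ ] ∑[ g′ < m₂ ] (((0# + [ v₁ f ≟ w ] * [ g′ ≟ g ]) - 0#) * y (σ f g′))
      + ∑[ f < m₁ ] ∑[ g′ < m₂ ] ((([ u₁ f ≟ w ] * [ g′ ≟ g ] + 0#) - 0#) * y (σ' f g′))
      ≈⟨ +-cong (∑∑-cong m₁ m₂ (λ f g′ → solve 4 (λ p q a z → ((z :+ p :* q) :- z) :* a := q :* (p :* a)) refl _ _ _ _))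
                (∑∑-cong m₁ m₂ (λ f g′ → solve 4 (λ p q a z → ((p :* q :+ z) :- z) :* a := q :* (p :* a)) refl _ _ _ _)) ⟩
    ∑[ f < m₁ ] ∑[ g′ < m₂ ] ([ g′ ≟ g ] * ([ v₁ f ≟ w ] * y (σ f g′)))
      + ∑[ f < m₁ ] ∑[ g′ < m₂ ] ([ g′ ≟ g ] * ([ u₁ f ≟ w ] * y (σ' f g′)))
      ≈⟨ +-cong (∑-cong m₁ (λ f → ∑-select {m₂} g _)) (∑-cong m₁ (λ f → ∑-select {m₂} g _)) ⟩
    ∑[ f < m₁ ] ([ v₁ f ≟ w ] * y (σ f g)) + ∑[ f < m₁ ] ([ u₁ f ≟ w ] * y (σ' f g))
      ≈⟨ ∑-distrib-+ {m₁} _ _ ⟨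
    ∑[ f < m₁ ] ([ v₁ f ≟ w ] * y (σ f g) + [ u₁ f ≟ w ] * y (σ' f g)) ∎

  ∂·-dia : ∀ y f g → ∂· y (dia f g) ≈ - y (σ f g) - y (σ' f g)
  ∂·-dia y f g = begin
    ∂· y (dia f g)
      ≡⟨ sumT≡∑∑ (λ t → ∂ (dia f g) t * y t) ⟩
    ∑[ f′ < m₁ ] ∑[ g′ < m₂ ] (((0# + 0#) - [ f′ ≟ f ] * [ g′ ≟ g ]) * y (σ f′ g′))
      + ∑[ f′ < m₁ ] ∑[ g′ < m₂ ] (((0# + 0#) - [ f′ ≟ f ] * [ g′ ≟ g ]) * y (σ' f′ g′))
      ≈⟨ +-cong (∑∑-cong m₁ m₂ (λ f′ g′ → negated-selector _ _ _))
                (∑∑-cong m₁ m₂ (λ f′ g′ → negated-selector _ _ _)) ⟩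
    ∑[ f′ < m₁ ] ∑[ g′ < m₂ ] ([ f′ ≟ f ] * ([ g′ ≟ g ] * - y (σ f′ g′)))
      + ∑[ f′ < m₁ ] ∑[ g′ < m₂ ] ([ f′ ≟ f ] * ([ g′ ≟ g ] * - y (σ' f′ g′)))
      ≈⟨ +-cong (trans (∑∑-select {m₁} {m₂} f _) (∑-select {m₂} g _))
                (trans (∑∑-select {m₁} {m₂} f _) (∑-select {m₂} g _)) ⟩
    - y (σ f g) - y (σ' f g) ∎
    where
    negated-selector : ∀ p q a → ((0# + 0#) - p * q) * a ≈ p * (q * - a)
    negated-selector = solve 3 (λ p q a → ((con (ℤ.+ 0) :+ con (ℤ.+ 0)) :- p :* q) :* a := p :* (q :* (:- a))) refl

  verticalSource : (AEdge → Carrier) → Fin m₁ → Fin n₂ → Carrier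
  verticalSource x f w = x (ver f w) - [ w ≟ s₂ ] + ∑[ g < m₂ ] ([ v₂ g ≟ w ] * x (dia f g))

  horizontalSource : (AEdge → Carrier) → Fin n₁ → Fin m₂ → Carrier
  horizontalSource x w g = [ w ≟ s₁ ] - x (hor w g) - ∑[ f < m₁ ] ([ u₁ f ≟ w ] * x (dia f g))

  module _ (x : AEdge → Carrier) (y : Tri → Carrier)
           (x-dia : ∀ f g → x (dia f g) ≈ - y (σ f g) - y (σ' f g)) where

    verticalSource-defect : ∀ f w →
      verticalSource x f w ≈ D₂.divergence (λ g → y (σ f g)) w + (x (ver f w) - (xinit s₁ s₂ (ver f w) + ∂· y (ver f w)))
    verticalSource-defect f w = begin
      x (ver f w) - [ w ≟ s₂ ] + ∑[ g < m₂ ] ([ v₂ g ≟ w ] * x (dia f g))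
        ≈⟨ +-congˡ (∑-cong m₂ (λ g → trans (*-congˡ (x-dia f g)) (pointwise _ _ _ _))) ⟩
      x (ver f w) - [ w ≟ s₂ ] + ∑[ g < m₂ ] (D₂.incidence g w * y (σ f g) - T g)
        ≈⟨ +-congˡ (∑-distrib-sub {m₂} _ T) ⟩
      x (ver f w) - [ w ≟ s₂ ] + (D₂.divergence (λ g → y (σ f g)) w - ∑[ g < m₂ ] T g)
        ≈⟨ solve 4 (λ x s d t → x :- s :+ (d :- t) := d :+ (x :- (s :+ t))) refl _ _ _ _ ⟩
      D₂.divergence (λ g → y (σ f g)) w + (x (ver f w) - ([ w ≟ s₂ ] + ∑[ g < m₂ ] T g))
        ≈⟨ +-congˡ (+-congˡ (-‿cong (+-congˡ (∂·-ver y f w)))) ⟨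
      D₂.divergence (λ g → y (σ f g)) w + (x (ver f w) - ([ w ≟ s₂ ] + ∂· y (ver f w))) ∎
      where
      T : Fin m₂ → Carrier
      T g = [ u₂ g ≟ w ] * y (σ f g) + [ v₂ g ≟ w ] * y (σ' f g)
      pointwise : ∀ u v a a′ → v * (- a - a′) ≈ (u - v) * a - (u * a + v * a′)
      pointwise = solve 4 (λ u v a a′ → v :* ((:- a) :- a′) := (u :- v) :* a :- (u :* a :+ v :* a′)) refl

    horizontalSource-defect : ∀ w g →
      horizontalSource x w g + (x (hor w g) - (xinit s₁ s₂ (hor w g) + ∂· y (hor w g))) ≈ D₁.divergence (λ f → y (σ f g)) w
    horizontalSource-defect w g = begin
      [ w ≟ s₁ ] - x (hor w g) - ∑[ f < m₁ ] ([ u₁ f ≟ w ] * x (dia f g))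
        + (x (hor w g) - ([ w ≟ s₁ ] + ∂· y (hor w g)))
        ≈⟨ +-congˡ (+-congˡ (-‿cong (+-congˡ (∂·-hor y w g)))) ⟩
      [ w ≟ s₁ ] - x (hor w g) - ∑[ f < m₁ ] ([ u₁ f ≟ w ] * x (dia f g))
        + (x (hor w g) - ([ w ≟ s₁ ] + ∑[ f < m₁ ] T f))
        ≈⟨ solve 4 (λ s x p t → s :- x :- p :+ (x :- (s :+ t)) := :- (p :+ t)) refl _ _ _ _ ⟩
      - (∑[ f < m₁ ] ([ u₁ f ≟ w ] * x (dia f g)) + ∑[ f < m₁ ] T f)
        ≈⟨ -‿cong (∑-distrib-+ {m₁} _ T) ⟨
      - ∑[ f < m₁ ] ([ u₁ f ≟ w ] * x (dia f g) + T f)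
        ≈⟨ ∑-distrib-neg {m₁} _ ⟨
      ∑[ f < m₁ ] (- ([ u₁ f ≟ w ] * x (dia f g) + T f))
        ≈⟨ ∑-cong m₁ (λ f → trans (-‿cong (+-congʳ (*-congˡ (x-dia f g)))) (pointwise _ _ _ _)) ⟩
      D₁.divergence (λ f → y (σ f g)) w ∎
      where
      T : Fin m₁ → Carrier
      T f = [ v₁ f ≟ w ] * y (σ f g) + [ u₁ f ≟ w ] * y (σ' f g)
      pointwise : ∀ u v a a′ → - (u * (- a - a′) + (v * a + u * a′)) ≈ (u - v) * a
      pointwise = solve 4 (λ u v a a′ → :- (u :* ((:- a) :- a′) :+ (v :* a :+ u :* a′)) := (u :- v) :* a) refl

  HasDivergenceSolution : (AEdge → Carrier) → Set (c ⊔ ℓ₁)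
  HasDivergenceSolution x = ∃ (IsDivergenceSolution (verticalSource x) (horizontalSource x))

  inAffineImage⇔hasDivergenceSolution : ∀ x → InAffineImage s₁ s₂ x ⇔ HasDivergenceSolution x
  inAffineImage⇔hasDivergenceSolution x = mk⇔ to from
    where
    to : InAffineImage s₁ s₂ x → HasDivergenceSolution x
    to (y , x≈) = (λ f g → y (σ f g)) , vertical , horizontal
      where
      x-dia : ∀ f g → x (dia f g) ≈ - y (σ f g) - y (σ' f g)
      x-dia f g = trans (x≈ (dia f g)) (trans (+-identityˡ _) (∂·-dia y f g))
      vertical : ∀ f w → D₂.divergence (λ g → y (σ f g)) w ≈ verticalSource x f w
      vertical f w = sym (trans (verticalSource-defect x y x-dia f w)
                                (trans (+-congˡ (x≈y⇒x∙y⁻¹≈ε (x≈ (ver f w)))) (+-identityʳ _)))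
      horizontal : ∀ w g → D₁.divergence (λ f → y (σ f g)) w ≈ horizontalSource x w g
      horizontal w g = trans (sym (horizontalSource-defect x y x-dia w g))
                             (trans (+-congˡ (x≈y⇒x∙y⁻¹≈ε (x≈ (hor w g)))) (+-identityʳ _))

    from : HasDivergenceSolution x → InAffineImage s₁ s₂ x
    from (a , vertical , horizontal) = y , x≈
      where
      y : Tri → Carrier
      y (σ f g)  = a f g
      y (σ' f g) = - x (dia f g) - a f g
      x-dia : ∀ f g → x (dia f g) ≈ - y (σ f g) - y (σ' f g)
      x-dia f g = solve 2 (λ d a → d := (:- a) :- ((:- d) :- a)) refl (x (dia f g)) (a f g)
      x≈ : ∀ e → x e ≈ xinit s₁ s₂ e + ∂· y e
      x≈ (ver f w) = x∙y⁻¹≈ε⇒x≈y _ _ (identityʳ-unique _ _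
        (trans (sym (verticalSource-defect x y x-dia f w)) (sym (vertical f w))))
      x≈ (hor w g) = x∙y⁻¹≈ε⇒x≈y _ _ (identityʳ-unique _ _
        (trans (horizontalSource-defect x y x-dia w g) (horizontal w g)))
      x≈ (dia f g) = trans (x-dia f g) (trans (sym (∂·-dia y f g)) (sym (+-identityˡ _)))

  labelSum₁-1≈∑verticalSource : ∀ x f → sumE (λ e → x e * I₁ e f) - 1# ≈ ∑[ w < n₂ ] verticalSource x f w
  labelSum₁-1≈∑verticalSource x f = begin
    sumE (λ e → x e * I₁ e f) - 1#
      ≡⟨ ≡.cong (_- 1#) (sumE≡∑∑ (λ e → x e * I₁ e f)) ⟩
    ∑[ f′ < m₁ ] ∑[ w < n₂ ] (x (ver f′ w) * [ f′ ≟ f ])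
      + (∑[ w < n₁ ] ∑[ g < m₂ ] (x (hor w g) * 0#) + ∑[ f′ < m₁ ] ∑[ g < m₂ ] (x (dia f′ g) * [ f′ ≟ f ])) - 1#
      ≈⟨ +-congʳ (+-cong (∑∑-selectʳ {m₁} {n₂} f _)
                         (trans (+-congʳ (∑-zero n₁ (λ w → ∑-zero m₂ (λ g → zeroʳ _))))
                                (trans (+-identityˡ _) (∑∑-selectʳ {m₁} {m₂} f _)))) ⟩
    ∑[ w < n₂ ] x (ver f w) + ∑[ g < m₂ ] x (dia f g) - 1#
      ≈⟨ solve 3 (λ v d o → v :+ d :- o := v :- o :+ d) refl _ _ _ ⟩
    ∑[ w < n₂ ] x (ver f w) - 1# + ∑[ g < m₂ ] x (dia f g)
      ≈⟨ +-cong (+-congˡ (-‿cong (∑-indicator s₂))) (∑∑-indicator′ v₂ (λ g → x (dia f g))) ⟨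
    ∑[ w < n₂ ] x (ver f w) - ∑[ w < n₂ ] [ w ≟ s₂ ] + ∑[ w < n₂ ] ∑[ g < m₂ ] ([ v₂ g ≟ w ] * x (dia f g))
      ≈⟨ +-congʳ (∑-distrib-sub {n₂} _ _) ⟨
    ∑[ w < n₂ ] (x (ver f w) - [ w ≟ s₂ ]) + ∑[ w < n₂ ] ∑[ g < m₂ ] ([ v₂ g ≟ w ] * x (dia f g))
      ≈⟨ ∑-distrib-+ {n₂} _ _ ⟨
    ∑[ w < n₂ ] verticalSource x f w ∎

  1-labelSum₂≈∑horizontalSource : ∀ x g → 1# - sumE (λ e → x e * I₂ e g) ≈ ∑[ w < n₁ ] horizontalSource x w g
  1-labelSum₂≈∑horizontalSource x g = begin
    1# - sumE (λ e → x e * I₂ e g)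
      ≡⟨ ≡.cong (λ s → 1# - s) (sumE≡∑∑ (λ e → x e * I₂ e g)) ⟩
    1# - (∑[ f < m₁ ] ∑[ w < n₂ ] (x (ver f w) * 0#)
      + (∑[ w < n₁ ] ∑[ g′ < m₂ ] (x (hor w g′) * [ g′ ≟ g ]) + ∑[ f < m₁ ] ∑[ g′ < m₂ ] (x (dia f g′) * [ g′ ≟ g ])))
      ≈⟨ +-congˡ (-‿cong (trans (+-congʳ (∑-zero m₁ (λ f → ∑-zero n₂ (λ w → zeroʳ _))))
                         (trans (+-identityˡ _) (+-cong (∑-cong n₁ (λ w → ∑-selectʳ {m₂} g _))
                                                        (∑-cong m₁ (λ f → ∑-selectʳ {m₂} g _)))))) ⟩
    1# - (∑[ w < n₁ ] x (hor w g) + ∑[ f < m₁ ] x (dia f g))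
      ≈⟨ solve 3 (λ o h d → o :- (h :+ d) := o :- h :- d) refl _ _ _ ⟩
    1# - ∑[ w < n₁ ] x (hor w g) - ∑[ f < m₁ ] x (dia f g)
      ≈⟨ +-cong (+-congʳ (∑-indicator s₁)) (-‿cong (∑∑-indicator′ u₁ (λ f → x (dia f g)))) ⟨
    ∑[ w < n₁ ] [ w ≟ s₁ ] - ∑[ w < n₁ ] x (hor w g) - ∑[ w < n₁ ] ∑[ f < m₁ ] ([ u₁ f ≟ w ] * x (dia f g))
      ≈⟨ +-congʳ (∑-distrib-sub {n₁} _ _) ⟨
    ∑[ w < n₁ ] ([ w ≟ s₁ ] - x (hor w g)) - ∑[ w < n₁ ] ∑[ f < m₁ ] ([ u₁ f ≟ w ] * x (dia f g))
      ≈⟨ ∑-distrib-sub {n₁} _ _ ⟨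
    ∑[ w < n₁ ] horizontalSource x w g ∎

  netInflow : (AEdge → Carrier) → V → Carrier
  netInflow x u = sumE (λ e → [ head e ≟V u ] * x e) - sumE (λ e → [ tail e ≟V u ] * x e)

  diagonalNetInflow : (AEdge → Carrier) → Fin n₁ → Fin n₂ → Carrier
  diagonalNetInflow x w₁ w₂ =
    ∑[ f < m₁ ] ∑[ g < m₂ ] (([ v₁ f ≟ w₁ ] * [ v₂ g ≟ w₂ ] - [ u₁ f ≟ w₁ ] * [ u₂ g ≟ w₂ ]) * x (dia f g))

  netInflow-by-edge-type : ∀ x w₁ w₂ → netInflow x (w₁ , w₂) ≈
    - D₁.divergence (λ f → x (ver f w₂)) w₁ + (- D₂.divergence (λ g → x (hor w₁ g)) w₂ + diagonalNetInflow x w₁ w₂)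
  netInflow-by-edge-type x w₁ w₂ = begin
    netInflow x (w₁ , w₂)
      ≡⟨ ≡.cong₂ _-_ (sumE≡∑∑ (λ e → [ head e ≟V (w₁ , w₂) ] * x e))
                     (sumE≡∑∑ (λ e → [ tail e ≟V (w₁ , w₂) ] * x e)) ⟩
    (∑[ f < m₁ ] ∑[ w < n₂ ] (([ v₁ f ≟ w₁ ] * [ w ≟ w₂ ]) * x (ver f w))
      + (∑[ w < n₁ ] ∑[ g < m₂ ] (([ w ≟ w₁ ] * [ v₂ g ≟ w₂ ]) * x (hor w g))
        + ∑[ f < m₁ ] ∑[ g < m₂ ] (([ v₁ f ≟ w₁ ] * [ v₂ g ≟ w₂ ]) * x (dia f g))))
    - (∑[ f < m₁ ] ∑[ w < n₂ ] (([ u₁ f ≟ w₁ ] * [ w ≟ w₂ ]) * x (ver f w))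
      + (∑[ w < n₁ ] ∑[ g < m₂ ] (([ w ≟ w₁ ] * [ u₂ g ≟ w₂ ]) * x (hor w g))
        + ∑[ f < m₁ ] ∑[ g < m₂ ] (([ u₁ f ≟ w₁ ] * [ u₂ g ≟ w₂ ]) * x (dia f g))))
      ≈⟨ trans (solve 6 (λ a b d a′ b′ d′ → (a :+ (b :+ d)) :- (a′ :+ (b′ :+ d′)) := (a :- a′) :+ ((b :- b′) :+ (d :- d′)))
                      refl _ _ _ _ _ _)
               (sym (+-cong (∑∑-distrib-sub {m₁} {n₂} _ _)
                            (+-cong (∑∑-distrib-sub {n₁} {m₂} _ _) (∑∑-distrib-sub {m₁} {m₂} _ _)))) ⟩
    ∑[ f < m₁ ] ∑[ w < n₂ ] (([ v₁ f ≟ w₁ ] * [ w ≟ w₂ ]) * x (ver f w) - ([ u₁ f ≟ w₁ ] * [ w ≟ w₂ ]) * x (ver f w))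
      + (∑[ w < n₁ ] ∑[ g < m₂ ] (([ w ≟ w₁ ] * [ v₂ g ≟ w₂ ]) * x (hor w g) - ([ w ≟ w₁ ] * [ u₂ g ≟ w₂ ]) * x (hor w g))
        + ∑[ f < m₁ ] ∑[ g < m₂ ] (([ v₁ f ≟ w₁ ] * [ v₂ g ≟ w₂ ]) * x (dia f g) - ([ u₁ f ≟ w₁ ] * [ u₂ g ≟ w₂ ]) * x (dia f g)))
      ≈⟨ +-cong vertical (+-cong horizontal
           (∑∑-cong m₁ m₂ (λ f g → solve 3 (λ a b X → a :* X :- b :* X := (a :- b) :* X) refl _ _ _))) ⟩
    - D₁.divergence (λ f → x (ver f w₂)) w₁ + (- D₂.divergence (λ g → x (hor w₁ g)) w₂ + diagonalNetInflow x w₁ w₂) ∎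
    where
    vertical : ∑[ f < m₁ ] ∑[ w < n₂ ] (([ v₁ f ≟ w₁ ] * [ w ≟ w₂ ]) * x (ver f w)
                                       - ([ u₁ f ≟ w₁ ] * [ w ≟ w₂ ]) * x (ver f w))
               ≈ - D₁.divergence (λ f → x (ver f w₂)) w₁
    vertical = trans
      (∑∑-cong m₁ n₂ (λ f w → solve 4 (λ a b c X → (a :* b) :* X :- (c :* b) :* X := b :* (:- ((c :- a) :* X))) refl _ _ _ _))
      (trans (∑-cong m₁ (λ f → ∑-select w₂ _)) (∑-distrib-neg {m₁} _))
    horizontal : ∑[ w < n₁ ] ∑[ g < m₂ ] (([ w ≟ w₁ ] * [ v₂ g ≟ w₂ ]) * x (hor w g)
                                         - ([ w ≟ w₁ ] * [ u₂ g ≟ w₂ ]) * x (hor w g))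
                 ≈ - D₂.divergence (λ g → x (hor w₁ g)) w₂
    horizontal = trans
      (∑∑-cong n₁ m₂ (λ w g → solve 4 (λ b a c X → (b :* a) :* X :- (b :* c) :* X := b :* (:- ((c :- a) :* X))) refl _ _ _ _))
      (trans (∑∑-select {n₁} {m₂} w₁ _) (∑-distrib-neg {m₂} _))

  diagonalNetInflow-cancels : ∀ x w₁ w₂ → diagonalNetInflow x w₁ w₂
    + (D₂.divergence (λ g → ∑[ f < m₁ ] ([ u₁ f ≟ w₁ ] * x (dia f g))) w₂
       + D₁.divergence (λ f → ∑[ g < m₂ ] ([ v₂ g ≟ w₂ ] * x (dia f g))) w₁) ≈ 0#
  diagonalNetInflow-cancels x w₁ w₂ = begin
    diagonalNetInflow x w₁ w₂
      + (D₂.divergence (λ g → ∑[ f < m₁ ] ([ u₁ f ≟ w₁ ] * x (dia f g))) w₂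
         + D₁.divergence (λ f → ∑[ g < m₂ ] ([ v₂ g ≟ w₂ ] * x (dia f g))) w₁)
      ≈⟨ +-congˡ (+-cong (D₂.divergence-∑ {m₁} _ w₂)
                         (∑-cong m₁ (λ f → *-distribˡ-sum (D₁.incidence f w₁) (λ g → [ v₂ g ≟ w₂ ] * x (dia f g))))) ⟩
    diagonalNetInflow x w₁ w₂
      + (∑[ f < m₁ ] ∑[ g < m₂ ] (D₂.incidence g w₂ * ([ u₁ f ≟ w₁ ] * x (dia f g)))
         + ∑[ f < m₁ ] ∑[ g < m₂ ] (D₁.incidence f w₁ * ([ v₂ g ≟ w₂ ] * x (dia f g))))
      ≈⟨ trans (∑∑-distrib-+ {m₁} {m₂} _ _) (+-congˡ (∑∑-distrib-+ {m₁} {m₂} _ _)) ⟨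
    ∑[ f < m₁ ] ∑[ g < m₂ ] (([ v₁ f ≟ w₁ ] * [ v₂ g ≟ w₂ ] - [ u₁ f ≟ w₁ ] * [ u₂ g ≟ w₂ ]) * x (dia f g)
      + (D₂.incidence g w₂ * ([ u₁ f ≟ w₁ ] * x (dia f g)) + D₁.incidence f w₁ * ([ v₂ g ≟ w₂ ] * x (dia f g))))
      ≈⟨ ∑-zero m₁ (λ f → ∑-zero m₂ (λ g → cancel _ _ _ _ _)) ⟩
    0# ∎
    where
    cancel : ∀ u₁ v₁ u₂ v₂ X → (v₁ * v₂ - u₁ * u₂) * X + ((u₂ - v₂) * (u₁ * X) + (u₁ - v₁) * (v₂ * X)) ≈ 0#
    cancel = solve 5 (λ u₁ v₁ u₂ v₂ X →
      (v₁ :* v₂ :- u₁ :* u₂) :* X :+ ((u₂ :- v₂) :* (u₁ :* X) :+ (u₁ :- v₁) :* (v₂ :* X)) := con (ℤ.+ 0)) refl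

  module Balanced (balanced₁ : ∀ w → ∑[ f < m₁ ] D₁.incidence f w ≈ 0#)
           (balanced₂ : ∀ w → ∑[ g < m₂ ] D₂.incidence g w ≈ 0#) where

    divergence-horizontalSource : ∀ x w₁ w₂ → D₂.divergence (horizontalSource x w₁) w₂ ≈
      - D₂.divergence (λ g → x (hor w₁ g)) w₂ - D₂.divergence (λ g → ∑[ f < m₁ ] ([ u₁ f ≟ w₁ ] * x (dia f g))) w₂
    divergence-horizontalSource x w₁ w₂ =
      trans (D₂.divergence-sub _ _ w₂)
            (+-congʳ (trans (D₂.divergence-sub _ _ w₂)
                            (trans (+-congʳ (D₂.divergence-const balanced₂ [ w₁ ≟ s₁ ] w₂)) (+-identityˡ _))))

    divergence-verticalSource : ∀ x w₁ w₂ → D₁.divergence (λ f → verticalSource x f w₂) w₁ ≈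
      D₁.divergence (λ f → x (ver f w₂)) w₁ + D₁.divergence (λ f → ∑[ g < m₂ ] ([ v₂ g ≟ w₂ ] * x (dia f g))) w₁
    divergence-verticalSource x w₁ w₂ =
      trans (D₁.divergence-+ _ _ w₁)
            (+-congʳ (trans (D₁.divergence-sub _ _ w₁)
                            (trans (+-congˡ (-‿cong (D₁.divergence-const balanced₁ [ w₂ ≟ s₂ ] w₁)))
                                   (trans (+-congˡ -0#≈0#) (+-identityʳ _)))))

    netInflow-as-divergences : ∀ x w₁ w₂ → netInflow x (w₁ , w₂) ≈
      D₂.divergence (horizontalSource x w₁) w₂ - D₁.divergence (λ f → verticalSource x f w₂) w₁
    netInflow-as-divergences x w₁ w₂ = begin
      netInflow x (w₁ , w₂)
        ≈⟨ netInflow-by-edge-type x w₁ w₂ ⟩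
      - Vₓ + (- Hₓ + Δ)
        ≈⟨ solve 5 (λ V H Δ P Q → :- V :+ (:- H :+ Δ) := (:- H :- P) :- (V :+ Q) :+ (Δ :+ (P :+ Q))) refl _ _ _ _ _ ⟩
      (- Hₓ - P) - (Vₓ + Q) + (Δ + (P + Q))
        ≈⟨ +-congˡ (diagonalNetInflow-cancels x w₁ w₂) ⟩
      (- Hₓ - P) - (Vₓ + Q) + 0#
        ≈⟨ +-identityʳ _ ⟩
      (- Hₓ - P) - (Vₓ + Q)
        ≈⟨ +-cong (divergence-horizontalSource x w₁ w₂) (-‿cong (divergence-verticalSource x w₁ w₂)) ⟨
      D₂.divergence (horizontalSource x w₁) w₂ - D₁.divergence (λ f → verticalSource x f w₂) w₁ ∎
      where
      Vₓ Hₓ Δ P Q : Carrier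
      Vₓ = D₁.divergence (λ f → x (ver f w₂)) w₁
      Hₓ = D₂.divergence (λ g → x (hor w₁ g)) w₂
      Δ = diagonalNetInflow x w₁ w₂
      P = D₂.divergence (λ g → ∑[ f < m₁ ] ([ u₁ f ≟ w₁ ] * x (dia f g))) w₂
      Q = D₁.divergence (λ f → ∑[ g < m₂ ] ([ v₂ g ≟ w₂ ] * x (dia f g))) w₁

    hasDivergenceSolution⇒constraints : ∀ x → HasDivergenceSolution x → FlowConservation x × LabelConstraints x
    hasDivergenceSolution⇒constraints x (a , vertical , horizontal) = flow , label₁ , label₂
      where
      flow : FlowConservation x
      flow (w₁ , w₂) = begin
        netInflow x (w₁ , w₂)
          ≈⟨ netInflow-as-divergences x w₁ w₂ ⟩
        D₂.divergence (horizontalSource x w₁) w₂ - D₁.divergence (λ f → verticalSource x f w₂) w₁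
          ≈⟨ +-cong (D₂.divergence-cong (λ g → sym (horizontal w₁ g)) w₂)
                    (-‿cong (D₁.divergence-cong (λ f → sym (vertical f w₂)) w₁)) ⟩
        D₂.divergence (λ g → D₁.divergence (λ f → a f g) w₁) w₂ - D₁.divergence (λ f → D₂.divergence (a f) w₂) w₁
          ≈⟨ +-congˡ (-‿cong (divergence-comm a w₁ w₂)) ⟩
        D₂.divergence (λ g → D₁.divergence (λ f → a f g) w₁) w₂ - D₂.divergence (λ g → D₁.divergence (λ f → a f g) w₁) w₂
          ≈⟨ -‿inverseʳ _ ⟩
        0# ∎
      label₁ : ∀ f → sumE (λ e → x e * I₁ e f) ≈ 1#
      label₁ f = x∙y⁻¹≈ε⇒x≈y _ _
        (trans (labelSum₁-1≈∑verticalSource x f)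
               (trans (∑-cong n₂ (λ w → sym (vertical f w))) (D₂.∑-divergence (a f))))
      label₂ : ∀ g → sumE (λ e → x e * I₂ e g) ≈ 1#
      label₂ g = sym (x∙y⁻¹≈ε⇒x≈y _ _
        (trans (1-labelSum₂≈∑horizontalSource x g)
               (trans (∑-cong n₁ (λ w → sym (horizontal w g))) (D₁.∑-divergence (λ f → a f g)))))

    constraints⇒hasDivergenceSolution : IsConnected G₁ → IsConnected G₂ →
      ∀ x → FlowConservation x × LabelConstraints x → HasDivergenceSolution x
    constraints⇒hasDivergenceSolution connected₁ connected₂ x (flow , label₁ , label₂) =
      divergence-system-solvable connected₁ connected₂ s₁ s₂ (verticalSource x) (horizontalSource x)
        ∑vertical≈0 ∑horizontal≈0 compatible
      where
      ∑vertical≈0 : ∀ f → ∑[ w < n₂ ] verticalSource x f w ≈ 0#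
      ∑vertical≈0 f = trans (sym (labelSum₁-1≈∑verticalSource x f)) (x≈y⇒x∙y⁻¹≈ε (label₁ f))
      ∑horizontal≈0 : ∀ g → ∑[ w < n₁ ] horizontalSource x w g ≈ 0#
      ∑horizontal≈0 g = trans (sym (1-labelSum₂≈∑horizontalSource x g)) (x≈y⇒x∙y⁻¹≈ε (sym (label₂ g)))
      compatible : ∀ w₁ w₂ → D₁.divergence (λ f → verticalSource x f w₂) w₁ ≈ D₂.divergence (horizontalSource x w₁) w₂
      compatible w₁ w₂ = sym (x∙y⁻¹≈ε⇒x≈y _ _ (trans (sym (netInflow-as-divergences x w₁ w₂)) (flow (w₁ , w₂))))

theorem7 : ∀ {c ℓ₁ ℓ₂ : Level} (K : OrderedField c ℓ₁ ℓ₂) {L : Set}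
           (G₁ G₂ : LabeledDigraph L) →
           IsUEGraphClosed G₁ → IsUEGraphClosed G₂ →
           (s₁ : Fin (LabeledDigraph.nV G₁)) (s₂ : Fin (LabeledDigraph.nV G₂)) →
           (x : Alignment.AEdge G₁ G₂ → OrderedField.Carrier K) →
           Alignment.OverField.NonNeg G₁ G₂ K x →
           (Alignment.OverField.InAffineImage G₁ G₂ K s₁ s₂ x
             ⇔ (Alignment.OverField.FlowConservation G₁ G₂ K x
                × Alignment.OverField.LabelConstraints G₁ G₂ K x))
theorem7 K G₁ G₂ (connected₁ , _ , trail₁) (connected₂ , _ , trail₂) s₁ s₂ x _ =
  mk⇔ (hasDivergenceSolution⇒constraints x ∘ to)
      (from ∘ constraints⇒hasDivergenceSolution connected₁ connected₂ x)
  where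
  open AlignmentFlows K G₁ G₂ s₁ s₂
  open Balanced (D₁.closedEulerian⇒balanced trail₁) (D₂.closedEulerian⇒balanced trail₂)
  open Equivalence (inAffineImage⇔hasDivergenceSolution x)
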